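{- For every positive integer $m$, $C^{\mathcal D(m)}\ge\frac1m$.
   Context: For an integer $r$ and prime power $q^j$ ($j\ge1$), $\omega_r(q^j)=\frac1{q^{j-1}(q-1)}$ if $r\not\equiv1\pmod{q^{\lceil j/2\rceil}}$ and $\omega_r(q^j)=\frac{q^{\lfloor j/2\rfloor+1}+q^{\lfloor j/2\rfloor}-1}{q^{j+\lfloor j/2\rfloor-1}(q^2-1)}$ otherwise; $\omega_r(m)=\prod_{q^j\parallel m}\omega_r(q^j)$. Let $\underline m=\prod_{q^j\parallel m}q^{\lceil j/2\rceil}$ and $$C^{\mathcal D(m)}=\frac1{\phi(\underline m)}\sum_{\substack{1\le r\le\underline m\\ (r,\underline m)=1}}\omega_r(m).$$ -}

module Defs where

open import Data.Nat using (ℕ; zero; suc; _+_; _*_; _∸_; _^_; ⌊_/2⌋; ⌈_/2⌉)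
open import Data.Nat.Divisibility using (_∣_; _∣?_)
open import Data.Nat.Primality using (Prime; prime?)
open import Data.Nat.Coprimality using (Coprime; coprime?)
open import Data.Integer using (+_)
open import Data.Rational using (ℚ; _/_; 0ℚ; 1ℚ) renaming (_*_ to _*ℚ_; _+_ to _+ℚ_)
open import Data.List using (List; filter; foldr; map; upTo)
open import Data.Product using (_×_)
open import Relation.Nullary.Decidable using (_×-dec_; Dec; yes; no)

-- a // d : the rational a/d (only ever used with d ≥ 1; returns 0 when d = 0)
_//_ : ℕ → ℕ → ℚ
a // zero = 0ℚ
a // suc d = (+ a) / suc d

largestPow : ℕ → ℕ → ℕ → ℕ
largestPow q m zero = zero
largestPow q m (suc k) with (q ^ suc k) ∣? m
... | yes _ = suc k
... | no  _ = largestPow q m k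

val : ℕ → ℕ → ℕ
val q m = largestPow q m m

primeDivisors : ℕ → List ℕ
primeDivisors m = filter (λ q → prime? q ×-dec q ∣? m) (upTo (suc m))

-- ω_r(q^j) for j ≥ 1, r ≥ 1 (r ≡ 1 mod q^c  ⇔  q^c ∣ r - 1 since r ≥ 1)
ωpp : ℕ → ℕ → ℕ → ℚ
ωpp r q j with (q ^ ⌈ j /2⌉) ∣? (r ∸ 1)
... | no  _ = 1 // (q ^ (j ∸ 1) * (q ∸ 1))
... | yes _ = (q ^ (⌊ j /2⌋ + 1) + q ^ ⌊ j /2⌋ ∸ 1)
              // (q ^ (j + ⌊ j /2⌋ ∸ 1) * (q ^ 2 ∸ 1))

ω : ℕ → ℕ → ℚ
ω r m = foldr (λ q acc → ωpp r q (val q m) *ℚ acc) 1ℚ (primeDivisors m)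

under : ℕ → ℕ
under m = foldr (λ q acc → q ^ ⌈ val q m /2⌉ * acc) 1 (primeDivisors m)

units : ℕ → List ℕ
units n = filter (λ r → coprime? r n) (map suc (upTo n))

φ : ℕ → ℕ
φ n = Data.List.length (units n)

sumℚ : List ℚ → ℚ
sumℚ = foldr _+ℚ_ 0ℚ

CD : ℕ → ℚ
CD m = (1 // φ (under m)) *ℚ sumℚ (map (λ r → ω r m) (units (under m)))

-- For a prime power q^j ∥ m, both branches of ω_r(q^j) are at least 1/q^j, so by multiplicativity
-- ω_r(m) ≥ 1/∏_{q^j ∥ m} q^j ≥ 1/m for every r, and C^{D(m)}, being an average of the ω_r(m),
-- inherits the bound.
module Submission where

open import Defs
open import Data.Nat using (ℕ; _≥_)
open import Data.Rational using (_≤_)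

open import Data.Nat as ℕ using (zero; suc; NonZero; _^_; _∸_; ⌊_/2⌋; ⌈_/2⌉)
import Data.Nat.Properties as ℕₚ
open import Data.Nat.Divisibility using (_∣_; divides; _∣?_; 1∣_; ∣-trans; ∣⇒≤; *-monoˡ-∣)
open import Data.Nat.Coprimality as Coprimality using (Coprime; coprime?; coprime-divisor; 1-coprimeTo)
open import Data.Nat.Primality using (Prime; prime?; prime⇒irreducible; prime⇒nonZero; prime⇒nonTrivial)
open import Data.Integer as ℤ using (+_)
import Data.Integer.Properties as ℤₚ
import Data.Rational as ℚ
import Data.Rational.Properties as ℚₚ
open import Data.Rational.Unnormalised as ℚᵘ using (mkℚᵘ) renaming (_≃_ to _≃ᵘ_)
import Data.Rational.Unnormalised.Properties as ℚᵘₚ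
open import Data.List using (List; []; _∷_; foldr; map; filter; length; upTo)
open import Data.List.Properties using (filter-accept)
open import Data.List.Relation.Unary.All as All using (All; []; _∷_)
open import Data.List.Relation.Unary.All.Properties using (all-filter)
open import Data.List.Relation.Unary.AllPairs using (AllPairs; []; _∷_)
open import Data.List.Relation.Unary.Unique.Propositional.Properties using (filter⁺; upTo⁺)
open import Data.Nat.Solver using (module +-*-Solver)
open import Data.Product using (_×_; _,_; proj₁)
open import Data.Sum using (inj₁; inj₂)
open import Function using (_∘_)
open import Relation.Binary.PropositionalEquality
open import Relation.Nullary using (yes; no; contradiction)
open import Relation.Nullary.Decidable using (_×-dec_)
open import Relation.Unary using (Decidable)

private variable a b c m : ℕ

toℚᵘ-// : ∀ a b .{{_ : NonZero b}} → ℚ.toℚᵘ (a // b) ≃ᵘ mkℚᵘ (+ a) (ℕ.pred b)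
toℚᵘ-// a (suc b) = ℚₚ.toℚᵘ-fromℚᵘ (mkℚᵘ (+ a) b)

//-≤ : ∀ a b c d .{{_ : NonZero b}} .{{_ : NonZero d}} → a ℕ.* d ℕ.≤ c ℕ.* b → a // b ≤ c // d
//-≤ a b@(suc _) c d@(suc _) ad≤cb = ℚₚ.toℚᵘ-cancel-≤
  (ℚᵘₚ.≤-respˡ-≃ (ℚᵘₚ.≃-sym (toℚᵘ-// a b)) (ℚᵘₚ.≤-respʳ-≃ (ℚᵘₚ.≃-sym (toℚᵘ-// c d))
    (ℚᵘ.*≤* (subst₂ ℤ._≤_ (ℤₚ.pos-* a d) (ℤₚ.pos-* c b) (ℤ.+≤+ ad≤cb)))))

//-*-// : ∀ a b c d .{{_ : NonZero b}} .{{_ : NonZero d}} →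
         (a // b) ℚ.* (c // d) ≡ (a ℕ.* c) // (b ℕ.* d)
//-*-// a b@(suc _) c d@(suc _) = ℚₚ.toℚᵘ-injective (begin
  ℚ.toℚᵘ ((a // b) ℚ.* (c // d))                       ≈⟨ ℚₚ.toℚᵘ-homo-* (a // b) (c // d) ⟩
  ℚ.toℚᵘ (a // b) ℚᵘ.* ℚ.toℚᵘ (c // d)                 ≈⟨ ℚᵘₚ.*-cong (toℚᵘ-// a b) (toℚᵘ-// c d) ⟩
  mkℚᵘ (+ a ℤ.* + c) (ℕ.pred (b ℕ.* d))                ≡⟨ cong (λ n → mkℚᵘ n _) (ℤₚ.pos-* a c) ⟨
  mkℚᵘ (+ (a ℕ.* c)) (ℕ.pred (b ℕ.* d))                ≈⟨ toℚᵘ-// (a ℕ.* c) (b ℕ.* d) ⟨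
  ℚ.toℚᵘ ((a ℕ.* c) // (b ℕ.* d))                      ∎)
  where open ℚᵘₚ.≃-Reasoning

//-+-// : ∀ a b c d .{{_ : NonZero b}} .{{_ : NonZero d}} →
         (a // b) ℚ.+ (c // d) ≡ (a ℕ.* d ℕ.+ c ℕ.* b) // (b ℕ.* d)
//-+-// a b@(suc _) c d@(suc _) = ℚₚ.toℚᵘ-injective (begin
  ℚ.toℚᵘ ((a // b) ℚ.+ (c // d))                       ≈⟨ ℚₚ.toℚᵘ-homo-+ (a // b) (c // d) ⟩
  ℚ.toℚᵘ (a // b) ℚᵘ.+ ℚ.toℚᵘ (c // d)                 ≈⟨ ℚᵘₚ.+-cong (toℚᵘ-// a b) (toℚᵘ-// c d) ⟩
  mkℚᵘ (+ a ℤ.* + d ℤ.+ + c ℤ.* + b) (ℕ.pred (b ℕ.* d)) ≡⟨ cong (λ n → mkℚᵘ n _) numerator ⟨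
  mkℚᵘ (+ (a ℕ.* d ℕ.+ c ℕ.* b)) (ℕ.pred (b ℕ.* d))    ≈⟨ toℚᵘ-// (a ℕ.* d ℕ.+ c ℕ.* b) (b ℕ.* d) ⟨
  ℚ.toℚᵘ ((a ℕ.* d ℕ.+ c ℕ.* b) // (b ℕ.* d))          ∎)
  where
  open ℚᵘₚ.≃-Reasoning
  numerator : + (a ℕ.* d ℕ.+ c ℕ.* b) ≡ + a ℤ.* + d ℤ.+ + c ℤ.* + b
  numerator = trans (ℤₚ.pos-+ (a ℕ.* d) (c ℕ.* b)) (cong₂ ℤ._+_ (ℤₚ.pos-* a d) (ℤₚ.pos-* c b))

1//-anti-mono : ∀ b d .{{_ : NonZero b}} .{{_ : NonZero d}} → b ℕ.≤ d → 1 // d ≤ 1 // b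
1//-anti-mono b d b≤d = //-≤ 1 d 1 b (ℕₚ.*-monoʳ-≤ 1 b≤d)

//-nonNegative : ∀ a b .{{_ : NonZero b}} → ℚ.NonNegative (a // b)
//-nonNegative a b = ℚ.nonNegative (//-≤ 0 1 a b ℕ.z≤n)

^*pred≤^suc : ∀ q i → q ^ i ℕ.* (q ∸ 1) ℕ.≤ q ^ suc i
^*pred≤^suc q i = begin
  q ^ i ℕ.* (q ∸ 1) ≤⟨ ℕₚ.*-monoʳ-≤ (q ^ i) (ℕₚ.m∸n≤m q 1) ⟩
  q ^ i ℕ.* q       ≡⟨ ℕₚ.*-comm (q ^ i) q ⟩
  q ^ suc i         ∎
  where open ℕₚ.≤-Reasoning

^*[^2∸1]≤[^suc+^∸1]*^suc : ∀ q i f .{{_ : NonZero q}} →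
  q ^ (i ℕ.+ f) ℕ.* (q ^ 2 ∸ 1) ℕ.≤ (q ^ (f ℕ.+ 1) ℕ.+ q ^ f ∸ 1) ℕ.* q ^ suc i
^*[^2∸1]≤[^suc+^∸1]*^suc q i f = begin
  q ^ (i ℕ.+ f) ℕ.* (q ^ 2 ∸ 1)     ≤⟨ ℕₚ.*-monoʳ-≤ (q ^ (i ℕ.+ f)) (ℕₚ.m∸n≤m (q ^ 2) 1) ⟩
  q ^ (i ℕ.+ f) ℕ.* q ^ 2           ≡⟨ ℕₚ.^-distribˡ-+-* q (i ℕ.+ f) 2 ⟨
  q ^ (i ℕ.+ f ℕ.+ 2)               ≡⟨ cong (q ^_) (exponents i f) ⟩
  q ^ (f ℕ.+ 1 ℕ.+ suc i)           ≡⟨ ℕₚ.^-distribˡ-+-* q (f ℕ.+ 1) (suc i) ⟩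
  q ^ (f ℕ.+ 1) ℕ.* q ^ suc i       ≤⟨ ℕₚ.*-monoˡ-≤ (q ^ suc i) (m≤m+n∸1 (q ^ (f ℕ.+ 1)) (q ^ f) (ℕₚ.m^n>0 q f)) ⟩
  (q ^ (f ℕ.+ 1) ℕ.+ q ^ f ∸ 1) ℕ.* q ^ suc i ∎
  where
  open ℕₚ.≤-Reasoning
  open +-*-Solver
  m≤m+n∸1 : ∀ x y → 0 ℕ.< y → x ℕ.≤ x ℕ.+ y ∸ 1
  m≤m+n∸1 x y y>0 = ℕₚ.≤-trans (ℕₚ.m≤m+n x (y ∸ 1)) (ℕₚ.≤-reflexive (sym (ℕₚ.+-∸-assoc x y>0)))
  exponents : ∀ i f → i ℕ.+ f ℕ.+ 2 ≡ f ℕ.+ 1 ℕ.+ suc i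
  exponents = solve 2 (λ i f → i :+ f :+ con 2 := f :+ con 1 :+ (con 1 :+ i)) refl

ωpp-lower : ∀ r q j → 2 ℕ.≤ q → 1 ℕ.≤ j → 1 // (q ^ j) ≤ ωpp r q j
ωpp-lower r 0 j () _
ωpp-lower r 1 j (ℕ.s≤s ()) _
ωpp-lower r (suc (suc p)) 0 _ ()
ωpp-lower r q@(suc (suc p)) (suc i) _ _ with q ^ ⌈ suc i /2⌉ ∣? r ∸ 1
... | no _  = 1//-anti-mono (q ^ i ℕ.* suc p) (q ^ suc i)
                {{ℕₚ.m*n≢0 (q ^ i) (suc p) {{ℕₚ.m^n≢0 q i}}}} {{ℕₚ.m^n≢0 q (suc i)}}
                (^*pred≤^suc q i)
... | yes _ = //-≤ 1 (q ^ suc i) _ (q ^ (i ℕ.+ ⌊ suc i /2⌋) ℕ.* (q ^ 2 ∸ 1))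
                {{ℕₚ.m^n≢0 q (suc i)}} {{ℕₚ.m*n≢0 _ (q ^ 2 ∸ 1) {{ℕₚ.m^n≢0 q (i ℕ.+ ⌊ suc i /2⌋)}}}}
                (ℕₚ.≤-trans (ℕₚ.≤-reflexive (ℕₚ.*-identityˡ _))
                            (^*[^2∸1]≤[^suc+^∸1]*^suc q i ⌊ suc i /2⌋))

∏ℕ : (ℕ → ℕ) → List ℕ → ℕ
∏ℕ e = foldr (λ q acc → e q ℕ.* acc) 1

∏ℚ : (ℕ → ℚ.ℚ) → List ℕ → ℚ.ℚ
∏ℚ g = foldr (λ q acc → g q ℚ.* acc) ℚ.1ℚ

∏ℕ-nonZero : ∀ e L → All (NonZero ∘ e) L → NonZero (∏ℕ e L)
∏ℕ-nonZero e []      []        = _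
∏ℕ-nonZero e (q ∷ L) (nz ∷ nzs) = ℕₚ.m*n≢0 (e q) (∏ℕ e L) {{nz}} {{∏ℕ-nonZero e L nzs}}

1//∏ℕ≤∏ℚ : ∀ e g L → (nzs : All (NonZero ∘ e) L) → All (λ q → 1 // e q ≤ g q) L →
           1 // ∏ℕ e L ≤ ∏ℚ g L
1//∏ℕ≤∏ℚ e g []      []         []         = ℚₚ.≤-refl
1//∏ℕ≤∏ℚ e g (q ∷ L) (nz ∷ nzs) (le ∷ les) = begin
  1 // (e q ℕ.* ∏ℕ e L)        ≡⟨ //-*-// 1 (e q) 1 (∏ℕ e L) ⟨
  (1 // e q) ℚ.* (1 // ∏ℕ e L) ≤⟨ ℚₚ.*-monoʳ-≤-nonNeg (1 // ∏ℕ e L) le ⟩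
  g q ℚ.* (1 // ∏ℕ e L)        ≤⟨ ℚₚ.*-monoˡ-≤-nonNeg (g q) {{g≥0}} (1//∏ℕ≤∏ℚ e g L nzs les) ⟩
  g q ℚ.* ∏ℚ g L               ∎
  where
  open ℚₚ.≤-Reasoning
  instance
    _ = nz
    _ = ∏ℕ-nonZero e L nzs
    _ = //-nonNegative 1 (∏ℕ e L)
  g≥0 : ℚ.NonNegative (g q)
  g≥0 = ℚ.nonNegative (ℚₚ.≤-trans (//-≤ 0 1 1 (e q) ℕ.z≤n) le)

coprime-*ʳ : Coprime a b → Coprime a c → Coprime a (b ℕ.* c)
coprime-*ʳ {a} {b} a⊥b a⊥c {i} (i∣a , i∣bc) = a⊥c (i∣a , coprime-divisor i⊥b i∣bc)
  where
  i⊥b : Coprime i b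
  i⊥b (j∣i , j∣b) = a⊥b (∣-trans j∣i i∣a , j∣b)

coprime-^ʳ : ∀ n → Coprime a b → Coprime a (b ^ n)
coprime-^ʳ {a} zero    a⊥b = Coprimality.sym (1-coprimeTo a)
coprime-^ʳ     (suc n) a⊥b = coprime-*ʳ a⊥b (coprime-^ʳ n a⊥b)

coprime-^ : ∀ k n → Coprime a b → Coprime (a ^ k) (b ^ n)
coprime-^ k n a⊥b = coprime-^ʳ n (Coprimality.sym (coprime-^ʳ k (Coprimality.sym a⊥b)))

distinct-primes-coprime : ∀ {p q} → Prime p → Prime q → p ≢ q → Coprime p q
distinct-primes-coprime {p} pp pq p≢q (i∣p , i∣q) with prime⇒irreducible pp i∣p
... | inj₁ i≡1 = i≡1
... | inj₂ refl with prime⇒irreducible pq i∣q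
...   | inj₁ p≡1 = contradiction p≡1 (ℕ.nonTrivial⇒≢1 {{prime⇒nonTrivial pp}})
...   | inj₂ p≡q = contradiction p≡q p≢q

coprime-∏ℕ : ∀ e L → All (λ q → Coprime a (e q)) L → Coprime a (∏ℕ e L)
coprime-∏ℕ {a} e []      []           = Coprimality.sym (1-coprimeTo a)
coprime-∏ℕ     e (q ∷ L) (a⊥eq ∷ a⊥e) = coprime-*ʳ a⊥eq (coprime-∏ℕ e L a⊥e)

coprime-*-∣ : Coprime a b → a ∣ m → b ∣ m → a ℕ.* b ∣ m
coprime-*-∣ {a} {b} a⊥b a∣m (divides k refl) =
  *-monoˡ-∣ b (coprime-divisor a⊥b (subst (a ∣_) (ℕₚ.*-comm k b) a∣m))

pairwise-coprime-∏ℕ-∣ : ∀ e L → AllPairs (λ p q → Coprime (e p) (e q)) L →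
                        All (λ q → e q ∣ m) L → ∏ℕ e L ∣ m
pairwise-coprime-∏ℕ-∣ {m} e []      []          []           = 1∣ m
pairwise-coprime-∏ℕ-∣     e (q ∷ L) (eq⊥ ∷ e⊥) (eq∣m ∷ e∣m) =
  coprime-*-∣ (coprime-∏ℕ e L eq⊥) eq∣m (pairwise-coprime-∏ℕ-∣ e L e⊥ e∣m)

distinct-prime-powers-coprime : ∀ (v : ℕ → ℕ) L → All Prime L → AllPairs _≢_ L →
                                AllPairs (λ p q → Coprime (p ^ v p) (q ^ v q)) L
distinct-prime-powers-coprime v []      []        []        = []
distinct-prime-powers-coprime v (p ∷ L) (pp ∷ ps) (p≢ ∷ ≢s) =
  All.zipWith p^⊥ (ps , p≢) ∷ distinct-prime-powers-coprime v L ps ≢s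
  where
  p^⊥ : ∀ {q} → Prime q × p ≢ q → Coprime (p ^ v p) (q ^ v q)
  p^⊥ {q} (pq , p≢q) = coprime-^ (v p) (v q) (distinct-primes-coprime pp pq p≢q)

^largestPow∣ : ∀ q m k → q ^ largestPow q m k ∣ m
^largestPow∣ q m zero    = 1∣ m
^largestPow∣ q m (suc k) with q ^ suc k ∣? m
... | yes q^k+1∣m = q^k+1∣m
... | no  _       = ^largestPow∣ q m k

∣⇒largestPow≥1 : ∀ q m k → q ∣ m → 1 ℕ.≤ largestPow q m (suc k)
∣⇒largestPow≥1 q m k q∣m with q ^ suc k ∣? m
∣⇒largestPow≥1 q m k       q∣m | yes _ = ℕ.s≤s ℕ.z≤n
∣⇒largestPow≥1 q m zero    q∣m | no q∤m = contradiction (subst (_∣ m) (sym (ℕₚ.*-identityʳ q)) q∣m) q∤m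
∣⇒largestPow≥1 q m (suc k) q∣m | no _ = ∣⇒largestPow≥1 q m k q∣m

primeDivisors-prime-∣ : ∀ m → All (λ q → Prime q × q ∣ m) (primeDivisors m)
primeDivisors-prime-∣ m = all-filter (λ q → prime? q ×-dec q ∣? m) (upTo (suc m))

primeDivisors-distinct : ∀ m → AllPairs _≢_ (primeDivisors m)
primeDivisors-distinct m = filter⁺ (λ q → prime? q ×-dec q ∣? m) (upTo⁺ (suc m))

filter-accept-nonZero : ∀ {P : ℕ → Set} (P? : Decidable P) {x} xs → P x →
                        NonZero (length (filter P? (x ∷ xs)))
filter-accept-nonZero P? xs px rewrite filter-accept P? {xs = xs} px = _

units-nonZero : ∀ n .{{_ : NonZero n}} → NonZero (length (units n))
units-nonZero n@(suc _) = filter-accept-nonZero (λ r → coprime? r n) _ (1-coprimeTo n)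

length//≤sum : ∀ (f : ℕ → ℚ.ℚ) P .{{_ : NonZero P}} L → (∀ r → 1 // P ≤ f r) →
               length L // P ≤ sumℚ (map f L)
length//≤sum f P []      f≥ = //-≤ 0 P 0 1 ℕ.z≤n
length//≤sum f P (r ∷ L) f≥ = begin
  suc (length L) // P                    ≤⟨ //-≤ _ P _ (P ℕ.* P) (ℕₚ.≤-reflexive (split (length L) P)) ⟩
  (1 ℕ.* P ℕ.+ length L ℕ.* P) // (P ℕ.* P) ≡⟨ //-+-// 1 P (length L) P ⟨
  (1 // P) ℚ.+ (length L // P)           ≤⟨ ℚₚ.+-mono-≤ (f≥ r) (length//≤sum f P L f≥) ⟩
  f r ℚ.+ sumℚ (map f L)                 ∎
  where
  open ℚₚ.≤-Reasoning
  open +-*-Solver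
  instance _ = ℕₚ.m*n≢0 P P
  split : ∀ n P → suc n ℕ.* (P ℕ.* P) ≡ (1 ℕ.* P ℕ.+ n ℕ.* P) ℕ.* P
  split = solve 2 (λ n P → (con 1 :+ n) :* (P :* P) := (con 1 :* P :+ n :* P) :* P) refl

average-lower : ∀ (f : ℕ → ℚ.ℚ) P .{{_ : NonZero P}} L .{{_ : NonZero (length L)}} →
                (∀ r → 1 // P ≤ f r) → 1 // P ≤ (1 // length L) ℚ.* sumℚ (map f L)
average-lower f P L f≥ = begin
  1 // P                              ≤⟨ //-≤ 1 P _ (length L ℕ.* P)
                                           (ℕₚ.≤-reflexive (sym (ℕₚ.*-assoc 1 (length L) P))) ⟩
  (1 ℕ.* length L) // (length L ℕ.* P) ≡⟨ //-*-// 1 (length L) (length L) P ⟨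
  (1 // length L) ℚ.* (length L // P) ≤⟨ ℚₚ.*-monoˡ-≤-nonNeg (1 // length L) {{//-nonNegative 1 (length L)}}
                                           (length//≤sum f P L f≥) ⟩
  (1 // length L) ℚ.* sumℚ (map f L)  ∎
  where
  open ℚₚ.≤-Reasoning
  instance _ = ℕₚ.m*n≢0 (length L) P

∏primePowers : ℕ → ℕ
∏primePowers m = ∏ℕ (λ q → q ^ val q m) (primeDivisors m)

primeDivisors-powers-nonZero : ∀ m (e : ℕ → ℕ) → All (NonZero ∘ λ q → q ^ e q) (primeDivisors m)
primeDivisors-powers-nonZero m e =
  All.map (λ {q} (pq , _) → ℕₚ.m^n≢0 q (e q) {{prime⇒nonZero pq}}) (primeDivisors-prime-∣ m)

∏primePowers-nonZero : ∀ m → NonZero (∏primePowers m)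
∏primePowers-nonZero m = ∏ℕ-nonZero _ (primeDivisors m) (primeDivisors-powers-nonZero m (λ q → val q m))

under-nonZero : ∀ m → NonZero (under m)
under-nonZero m = ∏ℕ-nonZero _ (primeDivisors m) (primeDivisors-powers-nonZero m (λ q → ⌈ val q m /2⌉))

∏primePowers∣ : ∀ m → ∏primePowers m ∣ m
∏primePowers∣ m = pairwise-coprime-∏ℕ-∣ _ (primeDivisors m)
  (distinct-prime-powers-coprime (λ q → val q m) _
    (All.map proj₁ (primeDivisors-prime-∣ m)) (primeDivisors-distinct m))
  (All.tabulate (λ {q} _ → ^largestPow∣ q m m))

1//∏primePowers≤ω : ∀ r m → m ≥ 1 → 1 // ∏primePowers m ≤ ω r m
1//∏primePowers≤ω r m@(suc m-1) _ =
  1//∏ℕ≤∏ℚ _ (λ q → ωpp r q (val q m)) (primeDivisors m)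
    (primeDivisors-powers-nonZero m (λ q → val q m))
    (All.map (λ {q} (pq , q∣m) → ωpp-lower r q (val q m) (ℕ.nonTrivial⇒n>1 q {{prime⇒nonTrivial pq}})
                                   (∣⇒largestPow≥1 q m m-1 q∣m))
             (primeDivisors-prime-∣ m))

proposition6p4 : (m : ℕ) → m ≥ 1 → (1 // m) ≤ CD m
proposition6p4 m@(suc _) m≥1 = begin
  1 // m                    ≤⟨ 1//-anti-mono (∏primePowers m) m (∣⇒≤ (∏primePowers∣ m)) ⟩
  1 // ∏primePowers m       ≤⟨ average-lower (λ r → ω r m) (∏primePowers m) (units (under m))
                                 (λ r → 1//∏primePowers≤ω r m m≥1) ⟩
  (1 // φ (under m)) ℚ.* sumℚ (map (λ r → ω r m) (units (under m))) ∎
  where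
  open ℚₚ.≤-Reasoning
  instance
    _ = ∏primePowers-nonZero m
    _ = units-nonZero (under m) {{under-nonZero m}}
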